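{- If $T$ is a tree of order $n$, then $DC(T)\le \Delta(T)+1$, where $\Delta(T)$ is the maximum degree of $T$.
   Context: Let $G=(V,E)$ be a finite simple undirected graph, $N[v]=\{v\}\cup N(v)$. A set $D\subseteq V$ is a double dominating set if $|N[v]\cap D|\ge 2$ for every $v\in V$. Two disjoint sets $V_1,V_2\subseteq V$ form a double coalition if neither is a double dominating set but $V_1\cup V_2$ is. A double coalition partition ($dc$-partition) of $G$ is a partition $\Pi$ of $V$ such that every set of $\Pi$ is not a double dominating set and forms a double coalition with some other set of $\Pi$. The double coalition number $DC(G)$ is the maximum cardinality of a $dc$-partition of $G$; by convention $DC(G)=0$ if $G$ has an isolated vertex. -}

module Defs where

open import Data.Nat using (ℕ; zero; suc; _+_; _≤_; _⊔_)
open import Data.Bool using (Bool; true; false; _∧_; _∨_; if_then_else_)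
open import Data.Fin using (Fin; zero; suc)
open import Data.Fin.Properties using () renaming (_≟_ to _≟ᶠ_)
open import Data.List using (List; []; _∷_; _++_; [_]; length; map; foldr; allFin)
open import Data.List.Relation.Unary.Unique.Propositional using (Unique)
open import Data.Product using (Σ; ∃; _×_; _,_)
open import Data.Unit using (⊤)
open import Data.Empty using (⊥)
open import Relation.Nullary using (¬_; does)
open import Relation.Binary.PropositionalEquality using (_≡_; _≢_)

record Graph (n : ℕ) : Set where
  field
    adj    : Fin n → Fin n → Bool
    sym    : ∀ u v → adj u v ≡ adj v u
    irrefl : ∀ v → adj v v ≡ false
open Graph public

count : ∀ {n} → (Fin n → Bool) → ℕ
count {zero}  P = 0
count {suc n} P = (if P zero then 1 else 0) + count (λ i → P (suc i))

deg : ∀ {n} → Graph n → Fin n → ℕ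
deg G v = count (adj G v)

maxDegree : ∀ {n} → Graph n → ℕ
maxDegree {n} G = foldr _⊔_ 0 (map (deg G) (allFin n))

data Walk {n} (G : Graph n) : Fin n → Fin n → Set where
  here : ∀ {v} → Walk G v v
  step : ∀ {u w v} → adj G u w ≡ true → Walk G w v → Walk G u v

Connected : ∀ {n} → Graph n → Set
Connected G = ∀ u v → Walk G u v

IsPath : ∀ {n} → Graph n → List (Fin n) → Set
IsPath G []            = ⊤
IsPath G (x ∷ [])      = ⊤
IsPath G (x ∷ y ∷ rs)  = (adj G x y ≡ true) × IsPath G (y ∷ rs)

HasCycle : ∀ {n} → Graph n → Set
HasCycle {n} G = Σ (Fin n) λ x → Σ (Fin n) λ y → Σ (List (Fin n)) λ vs →
  (1 ≤ length vs) × Unique (x ∷ vs ++ [ y ]) × IsPath G (x ∷ vs ++ [ y ]) × (adj G y x ≡ true)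

IsTree : ∀ {n} → Graph n → Set
IsTree G = Connected G × ¬ HasCycle G

inN : ∀ {n} → Graph n → Fin n → Fin n → Bool
inN G v u = does (u ≟ᶠ v) ∨ adj G v u

VSet : ℕ → Set
VSet n = Fin n → Bool

_∪_ : ∀ {n} → VSet n → VSet n → VSet n
(A ∪ B) u = A u ∨ B u

IsDoubleDominating : ∀ {n} → Graph n → VSet n → Set
IsDoubleDominating G D = ∀ v → 2 ≤ count (λ u → inN G v u ∧ D u)

-- a partition of V into k (nonempty) classes, given by a surjective labelling
block : ∀ {n k} → (Fin n → Fin k) → Fin k → VSet n
block c i u = does (c u ≟ᶠ i)

IsDoubleCoalition : ∀ {n} → Graph n → VSet n → VSet n → Set
IsDoubleCoalition G A B =
  ¬ IsDoubleDominating G A × ¬ IsDoubleDominating G B × IsDoubleDominating G (A ∪ B)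

IsDCPartition : ∀ {n} → Graph n → (k : ℕ) → (Fin n → Fin k) → Set
IsDCPartition G k c =
  (∀ i → ∃ λ u → c u ≡ i) ×
  (∀ i → ¬ IsDoubleDominating G (block c i)) ×
  (∀ i → ∃ λ j → (j ≢ i) × IsDoubleCoalition G (block c i) (block c j))

-- A forest has a vertex v of degree at most 1, so N[v] has at most two vertices and
-- every double dominating set contains v.  Hence the class A of v belongs to every
-- double coalition of a dc-partition: A is the partner of every other class.  As A
-- is not double dominating, some vertex x has r := |N[x] ∩ A| ≤ 1, and each of the
-- other k − 1 classes must meet N[x] in at least 2 − r vertices.  Summing over the
-- classes, r + (k − 1)(2 − r) ≤ |N[x]| ≤ Δ + 1, which forces k ≤ Δ + 1.

module Submission where

open import Defs hiding (sym)
open import Data.Nat using (ℕ; zero; suc; _+_; _*_; _∸_; _≤_; _<_; _⊔_; z≤n; s≤s)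
open import Data.Nat.Properties
open import Data.Fin using (Fin; zero; suc; punchIn)
open import Data.Fin.Properties using (any?; ¬∀⟶∃¬; punchInᵢ≢i) renaming (_≟_ to _≟ᶠ_)
open import Data.Bool using (Bool; true; false; _∧_; _∨_; if_then_else_) renaming (_≟_ to _≟ᵇ_)
open import Data.Bool.Properties using (∧-conicalˡ; ∧-distribˡ-∨)
open import Data.Product using (∃; _×_; _,_; proj₁; proj₂)
open import Data.Sum using (_⊎_; inj₁; inj₂)
open import Data.Empty using (⊥; ⊥-elim)
open import Data.Unit using (tt)
open import Data.List using (List; []; _∷_; _++_; [_]; length; foldr)
open import Data.List.Properties using (++-assoc)
import Data.List.Relation.Unary.Any as Any
open import Data.List.Relation.Unary.Any using (here; there)
open import Data.List.Relation.Unary.All using ([]; _∷_)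
open import Data.List.Relation.Unary.All.Properties using (¬Any⇒All¬; ++⁻ˡ)
open import Data.List.Relation.Unary.AllPairs using ([]; _∷_)
open import Data.List.Relation.Unary.Unique.Propositional using (Unique)
open import Data.List.Relation.Unary.Unique.Propositional.Properties using (Unique[x∷xs]⇒x∉xs)
open import Data.List.Membership.Propositional using (_∈_)
open import Data.List.Membership.Propositional.Properties using (∈-allFin; ∈-map⁺; ∈-∃++)
open import Function using (_∘_)
open import Relation.Nullary using (¬_; does; yes; no)
open import Relation.Nullary.Decidable using (dec-true; dec-false; decidable-stable; _×-dec_; ¬?)
open import Relation.Binary.PropositionalEquality using (_≡_; _≢_; refl; sym; trans; cong; cong₂; subst)
open import Algebra.Properties.CommutativeMonoid.Sum +-0-commutativeMonoid
  using (sum; ∑-distrib-+; sum-replicate-zero; sum-remove)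

count-mono : ∀ {n} {P Q : Fin n → Bool} → (∀ u → P u ≡ true → Q u ≡ true) → count P ≤ count Q
count-mono {zero} _ = z≤n
count-mono {suc n} {P} {Q} P⊆Q with P zero in P₀ | Q zero in Q₀
... | true  | true  = s≤s (count-mono (P⊆Q ∘ suc))
... | true  | false with () ← trans (sym (P⊆Q zero P₀)) Q₀
... | false | true  = m≤n⇒m≤1+n (count-mono (P⊆Q ∘ suc))
... | false | false = count-mono (P⊆Q ∘ suc)

count-≤ : ∀ {n} (P : Fin n → Bool) → count P ≤ n
count-≤ {zero} P = z≤n
count-≤ {suc n} P with P zero
... | true  = s≤s (count-≤ (P ∘ suc))
... | false = m≤n⇒m≤1+n (count-≤ (P ∘ suc))

count-const-false : ∀ {n} → count {n} (λ _ → false) ≡ 0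
count-const-false {zero}  = refl
count-const-false {suc n} = count-const-false {n}

count-≟ : ∀ {n} (z : Fin n) → count (λ u → does (u ≟ᶠ z)) ≡ 1
count-≟ {suc n} zero    = cong suc (count-const-false {n})
count-≟ {suc n} (suc z) = count-≟ z

count-∨ : ∀ {n} (P Q : Fin n → Bool) → count (λ u → P u ∨ Q u) ≤ count P + count Q
count-∨ {zero} P Q = z≤n
count-∨ {suc n} P Q with P zero | Q zero
... | true  | true  = s≤s (≤-trans (count-∨ (P ∘ suc) (Q ∘ suc)) (+-monoʳ-≤ (count (P ∘ suc)) (n≤1+n _)))
... | true  | false = s≤s (count-∨ (P ∘ suc) (Q ∘ suc))
... | false | true  = ≤-trans (s≤s (count-∨ (P ∘ suc) (Q ∘ suc))) (≤-reflexive (sym (+-suc _ _)))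
... | false | false = count-∨ (P ∘ suc) (Q ∘ suc)

count-∨-disjoint : ∀ {n} (P Q : Fin n → Bool) → (∀ u → P u ≡ true → Q u ≡ false) →
                   count (λ u → P u ∨ Q u) ≡ count P + count Q
count-∨-disjoint {zero} P Q _ = refl
count-∨-disjoint {suc n} P Q disjoint with P zero in P₀ | Q zero in Q₀
... | true  | true  with () ← trans (sym Q₀) (disjoint zero P₀)
... | true  | false = cong suc (count-∨-disjoint (P ∘ suc) (Q ∘ suc) (disjoint ∘ suc))
... | false | true  = trans (cong suc (count-∨-disjoint (P ∘ suc) (Q ∘ suc) (disjoint ∘ suc)))
                           (sym (+-suc _ _))
... | false | false = count-∨-disjoint (P ∘ suc) (Q ∘ suc) (disjoint ∘ suc)

count≥2⇒∃≢ : ∀ {n} (P : Fin n → Bool) → 2 ≤ count P → (z : Fin n) → ∃ λ w → P w ≡ true × w ≢ z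
count≥2⇒∃≢ P 2≤P z with any? (λ w → (P w ≟ᵇ true) ×-dec ¬? (w ≟ᶠ z))
... | yes found = found
... | no none   = ⊥-elim (<⇒≱ 2≤P (≤-trans (count-mono P⊆z) (≤-reflexive (count-≟ z))))
  where
  P⊆z : ∀ u → P u ≡ true → does (u ≟ᶠ z) ≡ true
  P⊆z u Pu = dec-true (u ≟ᶠ z) (decidable-stable (u ≟ᶠ z) (λ u≢z → none (u , Pu , u≢z)))

sum-indicator : ∀ {k} (a : Fin k) → sum (λ i → if does (a ≟ᶠ i) then 1 else 0) ≡ 1
sum-indicator {suc k} zero    = cong suc (sum-replicate-zero k)
sum-indicator {suc k} (suc a) = sum-indicator a

count≡∑-block : ∀ {n k} (P : Fin n → Bool) (c : Fin n → Fin k) →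
                count P ≡ sum (λ i → count (λ u → P u ∧ block c i u))
count≡∑-block {zero}  {k} P c = sym (sum-replicate-zero k)
count≡∑-block {suc n} {k} P c =
  trans (cong₂ _+_ (indicator (P zero)) (count≡∑-block (P ∘ suc) (c ∘ suc)))
        (sym (∑-distrib-+ {k} (λ i → if P zero ∧ block c i zero then 1 else 0)
                                   (λ i → count (λ u → P (suc u) ∧ block c i (suc u)))))
  where
  indicator : ∀ b → (if b then 1 else 0) ≡ sum (λ i → if b ∧ block c i zero then 1 else 0)
  indicator true  = sym (sum-indicator (c zero))
  indicator false = sym (sum-replicate-zero k)

∑-≥ : ∀ {k m} (f : Fin k → ℕ) → (∀ i → m ≤ f i) → k * m ≤ sum f
∑-≥ {zero}  f _   = z≤n
∑-≥ {suc k} f m≤f = +-mono-≤ (m≤f zero) (∑-≥ (f ∘ suc) (m≤f ∘ suc))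

∑-≥-except : ∀ {k m} (f : Fin (suc k) → ℕ) (a : Fin (suc k)) →
             (∀ i → i ≢ a → m ≤ f i) → f a + k * m ≤ sum f
∑-≥-except f a m≤f =
  ≤-trans (+-monoʳ-≤ (f a) (∑-≥ (f ∘ punchIn a) (λ i → m≤f (punchIn a i) (punchInᵢ≢i a i))))
          (≤-reflexive (sym (sum-remove {i = a} f)))

≤-foldr-⊔ : ∀ {x xs} → x ∈ xs → x ≤ foldr _⊔_ 0 xs
≤-foldr-⊔ (here refl)  = m≤m⊔n _ _
≤-foldr-⊔ {xs = y ∷ _} (there x∈) = ≤-trans (≤-foldr-⊔ x∈) (m≤n⊔m y _)

deg≤maxDegree : ∀ {n} (G : Graph n) v → deg G v ≤ maxDegree G
deg≤maxDegree G v = ≤-foldr-⊔ (∈-map⁺ (deg G) (∈-allFin v))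

count-inN≤deg+1 : ∀ {n} (G : Graph n) v → count (inN G v) ≤ deg G v + 1
count-inN≤deg+1 G v =
  ≤-trans (count-∨ (λ u → does (u ≟ᶠ v)) (adj G v))
          (≤-reflexive (trans (cong (_+ deg G v) (count-≟ v)) (+-comm 1 (deg G v))))

adj⇒≢ : ∀ {n} (G : Graph n) {u w} → adj G u w ≡ true → u ≢ w
adj⇒≢ G {u} u~w refl with () ← trans (sym u~w) (irrefl G u)

-- N[v] ∖ {v} ⊆ N(v), so a set missing v meets N[v] in at most deg v vertices.
deg≤1⇒∈-doubleDominating : ∀ {n} (G : Graph n) {v} → deg G v ≤ 1 →
                           ∀ {D} → IsDoubleDominating G D → D v ≡ true
deg≤1⇒∈-doubleDominating G {v} deg≤1 {D} dd with D v in Dv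
... | true  = refl
... | false = ⊥-elim (<⇒≱ (dd v) (≤-trans (count-mono N[v]∩D⊆N) deg≤1))
  where
  N[v]∩D⊆N : ∀ u → (inN G v u ∧ D u) ≡ true → adj G v u ≡ true
  N[v]∩D⊆N u uin with u ≟ᶠ v
  ... | yes refl with () ← trans (sym uin) Dv
  ... | no _     = ∧-conicalˡ _ _ uin

Unique-++⁻ˡ : ∀ {n} (xs : List (Fin n)) {ys} → Unique (xs ++ ys) → Unique xs
Unique-++⁻ˡ []       _           = []
Unique-++⁻ˡ (x ∷ xs) (x∉ ∷ uniq) = ++⁻ˡ xs x∉ ∷ Unique-++⁻ˡ xs uniq

count-∈≡length : ∀ {n} {xs : List (Fin n)} → Unique xs →
                 count (λ u → does (Any.any? (u ≟ᶠ_) xs)) ≡ length xs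
count-∈≡length {n} {[]} [] = count-const-false {n}
count-∈≡length {xs = x ∷ xs} uniq@(_ ∷ uniq′) =
  trans (count-∨-disjoint (λ u → does (u ≟ᶠ x)) _ x∉xs) (cong₂ _+_ (count-≟ x) (count-∈≡length uniq′))
  where
  x∉xs : ∀ u → does (u ≟ᶠ x) ≡ true → does (Any.any? (u ≟ᶠ_) xs) ≡ false
  x∉xs u _ with u ≟ᶠ x
  ... | yes refl = dec-false (Any.any? (u ≟ᶠ_) xs) (Unique[x∷xs]⇒x∉xs uniq)

Unique⇒length≤ : ∀ {n} {xs : List (Fin n)} → Unique xs → length xs ≤ n
Unique⇒length≤ uniq = ≤-trans (≤-reflexive (sym (count-∈≡length uniq))) (count-≤ _)

IsPath-++⁻ˡ : ∀ {n} (G : Graph n) (xs : List (Fin n)) {ys} → IsPath G (xs ++ ys) → IsPath G xs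
IsPath-++⁻ˡ G []           _       = tt
IsPath-++⁻ˡ G (x ∷ [])     _       = tt
IsPath-++⁻ˡ G (x ∷ y ∷ xs) (a , p) = a , IsPath-++⁻ˡ G (y ∷ xs) p

module _ {n} (G : Graph n) where

  cycle-from-path : ∀ {y z w rest} → Unique (y ∷ z ∷ rest) → IsPath G (y ∷ z ∷ rest) →
                    w ∈ rest → adj G y w ≡ true → HasCycle G
  cycle-from-path {y} {z} {w} uniq path w∈rest y~w with pre , post , refl ← ∈-∃++ w∈rest =
    y , w , z ∷ pre , s≤s z≤n ,
    Unique-++⁻ˡ (y ∷ z ∷ pre ++ [ w ]) (subst Unique (reassoc pre post) uniq) ,
    IsPath-++⁻ˡ G (y ∷ z ∷ pre ++ [ w ]) (subst (IsPath G) (reassoc pre post) path) ,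
    trans (Graph.sym G w y) y~w
    where
    reassoc : ∀ pre post → y ∷ z ∷ pre ++ [ w ] ++ post ≡ (y ∷ z ∷ pre ++ [ w ]) ++ post
    reassoc pre post = cong (λ l → y ∷ z ∷ l) (sym (++-assoc pre [ w ] post))

  -- Paths are listed newest vertex first.  With minimum degree 2 a path always extends
  -- by a new vertex (a repeated one closes a cycle), so `fuel` more steps would exceed
  -- n distinct vertices.
  extend-path : ¬ HasCycle G → (∀ v → 2 ≤ deg G v) →
                ∀ fuel {y z rest} → Unique (y ∷ z ∷ rest) → IsPath G (y ∷ z ∷ rest) →
                n < fuel + length (y ∷ z ∷ rest) → ⊥
  extend-path _ _ zero uniq _ long = <⇒≱ long (Unique⇒length≤ uniq)
  extend-path acyclic deg≥2 (suc fuel) {y} {z} {rest} uniq path long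
    with w , y~w , w≢z ← count≥2⇒∃≢ (adj G y) (deg≥2 y) z
    with Any.any? (w ≟ᶠ_) rest
  ... | yes w∈rest = acyclic (cycle-from-path uniq path w∈rest y~w)
  ... | no  w∉rest =
    extend-path acyclic deg≥2 fuel
      ((adj⇒≢ G w~y ∷ w≢z ∷ ¬Any⇒All¬ rest w∉rest) ∷ uniq) (w~y , path)
      (subst (n <_) (sym (+-suc fuel _)) long)
    where
    w~y : adj G w y ≡ true
    w~y = trans (Graph.sym G w y) y~w

acyclic⇒¬minDeg≥2 : ∀ {n} (G : Graph n) → ¬ HasCycle G → Fin n → ¬ (∀ v → 2 ≤ deg G v)
acyclic⇒¬minDeg≥2 {n} G acyclic x deg≥2
  with w , x~w , w≢x ← count≥2⇒∃≢ (adj G x) (deg≥2 x) x =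
  extend-path G acyclic deg≥2 n ((w≢x ∷ []) ∷ [] ∷ []) (trans (Graph.sym G w x) x~w , tt)
    (m<m+n n (s≤s z≤n))

acyclic⇒∃deg≤1 : ∀ {n} (G : Graph n) → ¬ HasCycle G → Fin n → ∃ λ v → deg G v ≤ 1
acyclic⇒∃deg≤1 G acyclic x with any? (λ v → deg G v ≤? 1)
... | yes found = found
... | no none   = ⊥-elim (acyclic⇒¬minDeg≥2 G acyclic x (λ v → ≰⇒> (λ le → none (v , le))))

block-∪⁻ : ∀ {n k} (c : Fin n → Fin k) {i j u} → (block c i ∪ block c j) u ≡ true →
           c u ≡ i ⊎ c u ≡ j
block-∪⁻ c {i} {j} {u} u∈ with c u ≟ᶠ i | c u ≟ᶠ j
block-∪⁻ c _  | yes cu≡i | _        = inj₁ cu≡i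
block-∪⁻ c _  | no _     | yes cu≡j = inj₂ cu≡j
block-∪⁻ c () | no _     | no _

IsCommonPartner : ∀ {n k} → Graph n → (Fin n → Fin k) → Fin k → Set
IsCommonPartner G c a = ∀ i → i ≢ a → IsDoubleDominating G (block c i ∪ block c a)

r+k*[2∸r]≤d+1⇒k<d+1 : ∀ {r} k d → r ≤ 1 → r + k * (2 ∸ r) ≤ d + 1 → k < d + 1
r+k*[2∸r]≤d+1⇒k<d+1 zero     d z≤n       _     = m≤n+m 1 d
r+k*[2∸r]≤d+1⇒k<d+1 (suc k)  d z≤n       bound = ≤-trans (s≤s (s≤s (m≤m*n k 2))) bound
r+k*[2∸r]≤d+1⇒k<d+1 k        d (s≤s z≤n) bound = subst (λ m → suc m ≤ d + 1) (*-identityʳ k) bound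

commonPartner⇒k≤maxDegree+1 : ∀ {n k} (G : Graph n) (c : Fin n → Fin (suc k)) (a : Fin (suc k)) →
                              ¬ IsDoubleDominating G (block c a) → IsCommonPartner G c a →
                              suc k ≤ maxDegree G + 1
commonPartner⇒k≤maxDegree+1 {n} {k} G c a ¬dd partner
  with x , x-bad ← ¬∀⟶∃¬ n _ (λ x → 2 ≤? count (λ u → inN G x u ∧ block c a u)) ¬dd =
  r+k*[2∸r]≤d+1⇒k<d+1 k (maxDegree G) (≤-pred (≰⇒> x-bad))
    (≤-trans (∑-≥-except f a others) total)
  where
  f : Fin (suc k) → ℕ
  f i = count (λ u → inN G x u ∧ block c i u)

  others : ∀ i → i ≢ a → 2 ∸ f a ≤ f i
  others i i≢a = m≤n+o⇒m∸n≤o 2 (f a)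
    (≤-trans (partner i i≢a x)
    (≤-trans (count-mono λ u → trans (sym (∧-distribˡ-∨ (inN G x u) (block c i u) (block c a u))))
    (≤-trans (count-∨ (λ u → inN G x u ∧ block c i u) (λ u → inN G x u ∧ block c a u))
             (≤-reflexive (+-comm (f i) (f a))))))

  total : sum f ≤ maxDegree G + 1
  total = ≤-trans (≤-reflexive (sym (count≡∑-block (inN G x) c)))
          (≤-trans (count-inN≤deg+1 G x) (+-monoˡ-≤ 1 (deg≤maxDegree G x)))

deg≤1⇒k≤maxDegree+1 : ∀ {n k} (G : Graph n) (c : Fin n → Fin (suc k)) → IsDCPartition G (suc k) c →
                      ∀ {v} → deg G v ≤ 1 → suc k ≤ maxDegree G + 1
deg≤1⇒k≤maxDegree+1 G c (_ , ¬dd , coalition) {v} deg≤1 =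
  commonPartner⇒k≤maxDegree+1 G c (c v) (¬dd (c v)) partner
  where
  partner : IsCommonPartner G c (c v)
  partner i i≢cv with j , _ , _ , _ , dd ← coalition i
    with block-∪⁻ c (deg≤1⇒∈-doubleDominating G deg≤1 dd)
  ... | inj₁ cv≡i = ⊥-elim (i≢cv (sym cv≡i))
  ... | inj₂ refl = dd

mainTheorem6 : ∀ (n : ℕ) (T : Graph n) → IsTree T →
    ∀ (k : ℕ) (c : Fin n → Fin k) → IsDCPartition T k c → k ≤ maxDegree T + 1
mainTheorem6 n T _ zero c _ = z≤n
mainTheorem6 n T (_ , acyclic) (suc k) c dc@(surjective , _) =
  deg≤1⇒k≤maxDegree+1 T c dc (proj₂ (acyclic⇒∃deg≤1 T acyclic (proj₁ (surjective zero))))
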